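{- For every integer $k\ge 1$, let $G_k$ be the graph defined as follows: start from the $4$-cycle on vertices $1,2,3,4$ with edges $12,23,34,41$; for each of these four edges $\{a,b\}$ and each $i\in\{1,\dots,k\}$, add two new vertices $(ab)_i$ and $(ba)_i$ together with the edges $a(ab)_i$, $(ab)_i(ba)_i$ and $(ba)_ib$ (so each edge of the original $4$-cycle lies on $k$ additional private $4$-cycles, and $n(G_k)=8k+4$). Then $\mu(G_k)=8k$ and $\chi_\mu(G_k)=2$.
   Context: For a connected graph $G$ and $S\subseteq V(G)$, two vertices $x,y\in S$ are $S$-visible if there is a shortest $x,y$-path $P$ in $G$ with $V(P)\cap S=\{x,y\}$. $S$ is a mutual-visibility set if any two vertices of $S$ are $S$-visible. The mutual-visibility number $\mu(G)$ is the largest cardinality of a mutual-visibility set. A mutual-visibility coloring of $G$ is a partition of $V(G)$ into mutual-visibility sets, and the mutual-visibility chromatic number $\chi_\mu(G)$ is the smallest number of classes in such a partition. -}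

module Defs where

open import Data.Nat using (ℕ; zero; suc; _≤_)
open import Data.Fin using (Fin; zero; suc)
open import Data.Bool using (Bool; true; false)
open import Data.Sum using (_⊎_; inj₁; inj₂)
open import Data.Product using (Σ; _×_; _,_)
open import Data.List using (List; []; _∷_; length)
open import Data.List.Relation.Unary.All using (All)
open import Data.List.Relation.Unary.Unique.Propositional using (Unique)
open import Data.List.Membership.Propositional using (_∈_)
open import Relation.Nullary using (¬_)
open import Relation.Binary.PropositionalEquality using (_≡_; _≢_)

record Graph : Set₁ where
  field
    V   : Set
    Adj : V → V → Set
open Graph public

module _ (G : Graph) where

  data Walk : V G → V G → Set where
    []  : ∀ {x} → Walk x x
    _∷_ : ∀ {x y z} → Adj G x y → Walk y z → Walk x z

  len : ∀ {x y} → Walk x y → ℕ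
  len []      = 0
  len (_ ∷ w) = suc (len w)

  interior : ∀ {x y} → Walk x y → List (V G)
  interior []                             = []
  interior (_ ∷ [])                       = []
  interior (_∷_ {y = y} _ w@(_ ∷ _))      = y ∷ interior w

  IsShortest : ∀ {x y} → Walk x y → Set
  IsShortest {x} {y} w = ∀ (w' : Walk x y) → len w ≤ len w'

  Visible : (V G → Set) → V G → V G → Set
  Visible S x y = Σ (Walk x y) λ w → IsShortest w × All (λ v → ¬ S v) (interior w)

  IsMVSet : (V G → Set) → Set
  IsMVSet S = ∀ x y → S x → S y → x ≢ y → Visible S x y

  -- μ(G) = m : m is the largest cardinality of a mutual-visibility set
  -- (finite vertex sets are represented by duplicate-free lists)
  MuEq : ℕ → Set
  MuEq m =
    (Σ (List (V G)) λ S → Unique S × IsMVSet (_∈ S) × length S ≡ m)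
    × (∀ (S : List (V G)) → Unique S → IsMVSet (_∈ S) → length S ≤ m)

  IsMVColoring : (c : ℕ) → (V G → Fin c) → Set
  IsMVColoring c col = ∀ (j : Fin c) → IsMVSet (λ v → col v ≡ j)

  ChiMuEq : ℕ → Set
  ChiMuEq c =
    (Σ (V G → Fin c) λ col → IsMVColoring c col)
    × (∀ (c' : ℕ) (col : V G → Fin c') → IsMVColoring c' col → c ≤ c')

-- Cycle vertices 1,2,3,4 are Fin 4 (0,1,2,3); cycle edge e joins e and next e.
-- The new vertex (ab)_i for edge e = {a,b} (a = e, b = next e) is
-- inj₂ (e , i , false); (ba)_i is inj₂ (e , i , true).

next : Fin 4 → Fin 4
next zero                   = suc zero
next (suc zero)             = suc (suc zero)
next (suc (suc zero))       = suc (suc (suc zero))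
next (suc (suc (suc zero))) = zero

VG : ℕ → Set
VG k = Fin 4 ⊎ (Fin 4 × Fin k × Bool)

data AdjG (k : ℕ) : VG k → VG k → Set where
  cyc   : ∀ a → AdjG k (inj₁ a) (inj₁ (next a))
  cyc'  : ∀ a → AdjG k (inj₁ (next a)) (inj₁ a)
  legA  : ∀ e i → AdjG k (inj₁ e) (inj₂ (e , i , false))
  legA' : ∀ e i → AdjG k (inj₂ (e , i , false)) (inj₁ e)
  mid   : ∀ e i → AdjG k (inj₂ (e , i , false)) (inj₂ (e , i , true))
  mid'  : ∀ e i → AdjG k (inj₂ (e , i , true)) (inj₂ (e , i , false))
  legB  : ∀ e i → AdjG k (inj₂ (e , i , true)) (inj₁ (next e))
  legB' : ∀ e i → AdjG k (inj₁ (next e)) (inj₂ (e , i , true))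

Gk : ℕ → Graph
Gk k = record { V = VG k ; Adj = AdjG k }

-- The lower bounds on walk lengths come from an explicit distance function d on G_k,
-- which vanishes on the diagonal and drops by at most one along an edge.
-- Any two new vertices see each other along a geodesic whose interior lies on the
-- 4-cycle (or along the edge joining them), so the 8k new vertices form a
-- mutual-visibility set. Conversely, at each corner c of the 4-cycle the vertices c,
-- (c c⁺)₁ and (c c⁻)₁ cannot all lie in a mutual-visibility set, because c is the only
-- interior vertex of the unique geodesic between the other two; this excludes four
-- distinct vertices, so μ(G_k) ≤ 8k. Colouring the corners 1, 2 together with the new
-- vertices attached to 3, 4 with one colour, and the rest with the other, gives a
-- mutual-visibility colouring once the geodesics between opposite corners are chosen
-- through a corner of the right class; a single colour fails because every shortest
-- 1,3-path has an interior vertex.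
module Submission where

open import Defs
open import Data.Nat using (ℕ; zero; suc; _≤_; _≤?_; _+_; _*_; z≤n; s≤s) renaming (_≟_ to _≟ⁿ_)
open import Data.Nat.Properties
  using (≤-trans; ≤-reflexive; ≤-refl; ≤-antisym; m≤n+m; *-comm; *-assoc; +-cancelˡ-≤; module ≤-Reasoning)
open import Data.Fin using (Fin; zero; suc)
open import Data.Fin.Patterns using (0F; 1F; 2F; 3F)
open import Data.Fin.Properties using (all?; 2↔Bool) renaming (_≟_ to _≟ᶠ_)
open import Data.Bool using (Bool; true; false; not; if_then_else_)
open import Data.Bool.Properties using (not-¬; not-injective) renaming (_≟_ to _≟ᵇ_)
open import Data.Sum using (inj₁; inj₂)
import Data.Sum.Properties as Sum
open import Data.Product using (Σ; _×_; _,_; proj₁; proj₂)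
import Data.Product.Properties as Product
open import Data.List using (List; []; _∷_; _∷ʳ_; _++_; length; map; reverse; allFin; cartesianProduct)
open import Data.List.Properties
  using (unfold-reverse; length-removeAt′; length-++; length-map; length-tabulate; map-++)
  renaming (≡-dec to ≡-decˡ)
open import Data.List.Relation.Unary.All as All using (All; []; _∷_)
import Data.List.Relation.Unary.All.Properties as All
open import Data.List.Relation.Unary.AllPairs using ([]; _∷_)
open import Data.List.Relation.Unary.Any using (here; there)
import Data.List.Relation.Unary.Any.Properties as Any
open import Data.List.Relation.Unary.Unique.Propositional using (Unique)
import Data.List.Relation.Unary.Unique.Propositional.Properties as Unique
open import Data.List.Membership.Propositional using (_∈_; _∉_; _─_)
import Data.List.Membership.Propositional.Properties as Membership
open import Data.List.Relation.Binary.Subset.Propositional using (_⊆_)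
open import Data.Empty using (⊥-elim)
open import Function using (_∘_; Inverse)
open import Relation.Nullary using (¬_; yes; no; does)
open import Relation.Nullary.Decidable using (from-yes; _→-dec_; dec-true; dec-false)
open import Relation.Binary.Definitions using (DecidableEquality)
open import Relation.Binary.PropositionalEquality

-- Walks

module _ {G : Graph} where

  infixl 5 _▷_
  _▷_ : ∀ {x y z} → Walk G x y → Adj G y z → Walk G x z
  []      ▷ q = q ∷ []
  (p ∷ w) ▷ q = p ∷ (w ▷ q)

  len-▷ : ∀ {x y z} (w : Walk G x y) (q : Adj G y z) → len G (w ▷ q) ≡ suc (len G w)
  len-▷ []      q = refl
  len-▷ (p ∷ w) q = cong suc (len-▷ w q)

  initVertices : ∀ {x y} → Walk G x y → List (V G)
  initVertices []          = []
  initVertices {x} (_ ∷ w) = x ∷ initVertices w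

  tailVertices : ∀ {x y} → Walk G x y → List (V G)
  tailVertices []                = []
  tailVertices (_∷_ {y = y} _ w) = y ∷ tailVertices w

  interior-∷ : ∀ {u x y} (p : Adj G u x) (w : Walk G x y) → interior G (p ∷ w) ≡ initVertices w
  interior-∷ p []      = refl
  interior-∷ p (q ∷ w) = cong (_ ∷_) (interior-∷ q w)

  initVertices-▷ : ∀ {x y z} (w : Walk G x y) (q : Adj G y z) → initVertices (w ▷ q) ≡ initVertices w ∷ʳ y
  initVertices-▷ []      q = refl
  initVertices-▷ (p ∷ w) q = cong (_ ∷_) (initVertices-▷ w q)

  initVertices-∷ʳ : ∀ {x y} (w : Walk G x y) → initVertices w ∷ʳ y ≡ x ∷ tailVertices w
  initVertices-∷ʳ []      = refl
  initVertices-∷ʳ (p ∷ w) = cong (_ ∷_) (initVertices-∷ʳ w)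

  interior-▷ : ∀ {x y z} (w : Walk G x y) (q : Adj G y z) → interior G (w ▷ q) ≡ tailVertices w
  interior-▷ []      q = refl
  interior-▷ (p ∷ w) q = begin
    interior G (p ∷ (w ▷ q))  ≡⟨ interior-∷ p (w ▷ q) ⟩
    initVertices (w ▷ q)      ≡⟨ initVertices-▷ w q ⟩
    initVertices w ∷ʳ _       ≡⟨ initVertices-∷ʳ w ⟩
    tailVertices (p ∷ w)      ∎
    where open ≡-Reasoning

  tailVertices-▷ : ∀ {x y z} (w : Walk G x y) (q : Adj G y z) → tailVertices (w ▷ q) ≡ tailVertices w ∷ʳ z
  tailVertices-▷ []      q = refl
  tailVertices-▷ (p ∷ w) q = cong (_ ∷_) (tailVertices-▷ w q)

  module Lipschitz (dist : V G → V G → ℕ) (dist-refl : ∀ x → dist x x ≡ 0)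
                   (dist-step : ∀ {x y} → Adj G x y → ∀ z → dist x z ≤ suc (dist y z)) where

    dist≤len : ∀ {x y} (w : Walk G x y) → dist x y ≤ len G w
    dist≤len {x} []          = ≤-reflexive (dist-refl x)
    dist≤len {y = z} (p ∷ w) = ≤-trans (dist-step p z) (s≤s (dist≤len w))

    len≤dist⇒isShortest : ∀ {x y} (w : Walk G x y) → len G w ≤ dist x y → IsShortest G w
    len≤dist⇒isShortest w w≤d w' = ≤-trans w≤d (dist≤len w')

  IsMVSet-⊆ : ∀ {S T : V G → Set} → (∀ v → T v → S v) → IsMVSet G S → IsMVSet G T
  IsMVSet-⊆ T⊆S mv x y Tx Ty x≢y with mv x y (T⊆S x Tx) (T⊆S y Ty) x≢y
  ... | w , shortest , avoid = w , shortest , All.map (λ ¬S T → ¬S (T⊆S _ T)) avoid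

module Symmetric {G : Graph} (flip : ∀ {x y} → Adj G x y → Adj G y x) where

  reverseʷ : ∀ {x y} → Walk G x y → Walk G y x
  reverseʷ []      = []
  reverseʷ (p ∷ w) = reverseʷ w ▷ flip p

  len-reverseʷ : ∀ {x y} (w : Walk G x y) → len G (reverseʷ w) ≡ len G w
  len-reverseʷ []      = refl
  len-reverseʷ (p ∷ w) = trans (len-▷ (reverseʷ w) (flip p)) (cong suc (len-reverseʷ w))

  tailVertices-reverseʷ : ∀ {x y} (w : Walk G x y) → tailVertices (reverseʷ w) ≡ reverse (initVertices w)
  tailVertices-reverseʷ {x} []      = refl
  tailVertices-reverseʷ {x} (p ∷ w) = begin
    tailVertices (reverseʷ w ▷ flip p)   ≡⟨ tailVertices-▷ (reverseʷ w) (flip p) ⟩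
    tailVertices (reverseʷ w) ∷ʳ x       ≡⟨ cong (_∷ʳ x) (tailVertices-reverseʷ w) ⟩
    reverse (initVertices w) ∷ʳ x        ≡⟨ unfold-reverse x (initVertices w) ⟨
    reverse (x ∷ initVertices w)         ∎
    where open ≡-Reasoning

  interior-reverseʷ : ∀ {x y} (w : Walk G x y) → interior G (reverseʷ w) ≡ reverse (interior G w)
  interior-reverseʷ []      = refl
  interior-reverseʷ (p ∷ w) = begin
    interior G (reverseʷ w ▷ flip p)     ≡⟨ interior-▷ (reverseʷ w) (flip p) ⟩
    tailVertices (reverseʷ w)            ≡⟨ tailVertices-reverseʷ w ⟩
    reverse (initVertices w)             ≡⟨ cong reverse (interior-∷ p w) ⟨
    reverse (interior G (p ∷ w))         ∎
    where open ≡-Reasoning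

  Visible-sym : ∀ {S x y} → Visible G S x y → Visible G S y x
  Visible-sym (w , shortest , avoid) =
    reverseʷ w ,
    (λ w' → subst₂ _≤_ (sym (len-reverseʷ w)) (len-reverseʷ w') (shortest (reverseʷ w'))) ,
    subst (All _) (sym (interior-reverseʷ w)) (All.tabulate (λ v∈ → All.lookup avoid (Any.reverse⁻ v∈)))

module _ {G H : Graph} (f : V G → V H) (f-adj : ∀ {x y} → Adj G x y → Adj H (f x) (f y)) where

  mapʷ : ∀ {x y} → Walk G x y → Walk H (f x) (f y)
  mapʷ []      = []
  mapʷ (p ∷ w) = f-adj p ∷ mapʷ w

  len-mapʷ : ∀ {x y} (w : Walk G x y) → len H (mapʷ w) ≡ len G w
  len-mapʷ []      = refl
  len-mapʷ (p ∷ w) = cong suc (len-mapʷ w)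

  initVertices-mapʷ : ∀ {x y} (w : Walk G x y) → initVertices (mapʷ w) ≡ map f (initVertices w)
  initVertices-mapʷ []      = refl
  initVertices-mapʷ (p ∷ w) = cong (_ ∷_) (initVertices-mapʷ w)

  interior-mapʷ : ∀ {x y} (w : Walk G x y) → interior H (mapʷ w) ≡ map f (interior G w)
  interior-mapʷ []          = refl
  interior-mapʷ (p ∷ [])    = refl
  interior-mapʷ (p ∷ q ∷ w) = cong (_ ∷_) (interior-mapʷ (q ∷ w))

module _ {A : Set} where

  ∈-─ : ∀ {x y : A} {xs} (x∈ : x ∈ xs) → y ∈ xs → y ≢ x → y ∈ xs ─ x∈
  ∈-─ (here refl) (here refl) y≢x = ⊥-elim (y≢x refl)
  ∈-─ (here refl) (there y∈) _    = y∈
  ∈-─ (there x∈)  (here refl) _   = here refl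
  ∈-─ (there x∈)  (there y∈) y≢x  = there (∈-─ x∈ y∈ y≢x)

  Unique⇒length≤ : ∀ {xs ys : List A} → Unique xs → xs ⊆ ys → length xs ≤ length ys
  Unique⇒length≤ {[]}     _             _   = z≤n
  Unique⇒length≤ {x ∷ xs} {ys} (x∉ ∷ u) xs⊆ys = begin
    suc (length xs)                ≤⟨ s≤s (Unique⇒length≤ u xs⊆ys─x) ⟩
    suc (length (ys ─ x∈ys))       ≡⟨ length-removeAt′ ys _ ⟨
    length ys                      ∎
    where
    open ≤-Reasoning
    x∈ys : x ∈ ys
    x∈ys = xs⊆ys (here refl)
    xs⊆ys─x : xs ⊆ ys ─ x∈ys
    xs⊆ys─x y∈ = ∈-─ x∈ys (xs⊆ys (there y∈)) (λ y≡x → All.lookup x∉ y∈ (sym y≡x))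

length-cartesianProduct : ∀ {A B : Set} (xs : List A) (ys : List B) →
                          length (cartesianProduct xs ys) ≡ length xs * length ys
length-cartesianProduct []       ys = refl
length-cartesianProduct (x ∷ xs) ys =
  trans (length-++ (map (x ,_) ys)) (cong₂ _+_ (length-map (x ,_) ys) (length-cartesianProduct xs ys))

-- The 4-cycle

data Step : Fin 4 → Fin 4 → Set where
  fwd : ∀ a → Step a (next a)
  bwd : ∀ a → Step (next a) a

C₄ : Graph
C₄ = record { V = Fin 4 ; Adj = Step }

-- Between opposite corners the geodesic turns at the neighbour on the side of its
-- start; the colouring relies on this choice through initVertices-geodesic₄.
geodesic₄ : (a b : Fin 4) → Walk C₄ a b
geodesic₄ 0F 0F = []
geodesic₄ 0F 1F = fwd 0F ∷ []
geodesic₄ 0F 2F = fwd 0F ∷ fwd 1F ∷ []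
geodesic₄ 0F 3F = bwd 3F ∷ []
geodesic₄ 1F 0F = bwd 0F ∷ []
geodesic₄ 1F 1F = []
geodesic₄ 1F 2F = fwd 1F ∷ []
geodesic₄ 1F 3F = bwd 0F ∷ bwd 3F ∷ []
geodesic₄ 2F 0F = fwd 2F ∷ fwd 3F ∷ []
geodesic₄ 2F 1F = bwd 1F ∷ []
geodesic₄ 2F 2F = []
geodesic₄ 2F 3F = fwd 2F ∷ []
geodesic₄ 3F 0F = fwd 3F ∷ []
geodesic₄ 3F 1F = bwd 2F ∷ bwd 1F ∷ []
geodesic₄ 3F 2F = bwd 2F ∷ []
geodesic₄ 3F 3F = []

d₄ : Fin 4 → Fin 4 → ℕ
d₄ a b = len C₄ (geodesic₄ a b)

side : Fin 4 → Bool
side 0F = false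
side 1F = false
side 2F = true
side 3F = true

d₄-refl : ∀ a → d₄ a a ≡ 0
d₄-refl = from-yes (all? λ a → d₄ a a ≟ⁿ 0)

d₄-step : ∀ {a b} → Step a b → ∀ c → d₄ a c ≤ suc (d₄ b c)
d₄-step (fwd a) = from-yes (all? λ a → all? λ c → d₄ a c ≤? suc (d₄ (next a) c)) a
d₄-step (bwd a) = from-yes (all? λ a → all? λ c → d₄ (next a) c ≤? suc (d₄ a c)) a

open Lipschitz {G = C₄} d₄ d₄-refl d₄-step using () renaming (dist≤len to d₄≤len)

d₄-adjacent : ∀ {a b} → Step a b → d₄ a b ≤ 1
d₄-adjacent p = d₄≤len (p ∷ [])

initVertices-geodesic₄ : ∀ a b → All (λ c → side c ≡ side a) (initVertices (geodesic₄ a b))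
initVertices-geodesic₄ =
  from-yes (all? λ a → all? λ b → All.all? (λ c → side c ≟ᵇ side a) (initVertices (geodesic₄ a b)))

interior-geodesic₄ : ∀ a b → side a ≡ side b → interior C₄ (geodesic₄ a b) ≡ []
interior-geodesic₄ =
  from-yes (all? λ a → all? λ b →
    (side a ≟ᵇ side b) →-dec ≡-decˡ _≟ᶠ_ (interior C₄ (geodesic₄ a b)) [])

-- The graph G_k

module Gₖ (k : ℕ) where

  G : Graph
  G = Gk k

  New : Set
  New = Fin 4 × Fin k × Bool

  anchor : New → Fin 4
  anchor (e , _ , false) = e
  anchor (e , _ , true)  = next e

  leave : (x : New) → AdjG k (inj₂ x) (inj₁ (anchor x))
  leave (e , i , false) = legA' e i
  leave (e , i , true)  = legB e i

  arrive : (x : New) → AdjG k (inj₁ (anchor x)) (inj₂ x)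
  arrive (e , i , false) = legA e i
  arrive (e , i , true)  = legB' e i

  step₄ : ∀ {a b} → Step a b → AdjG k (inj₁ a) (inj₁ b)
  step₄ (fwd a) = cyc a
  step₄ (bwd a) = cyc' a

  alongCycle : ∀ a b → Walk G (inj₁ a) (inj₁ b)
  alongCycle a b = mapʷ inj₁ step₄ (geodesic₄ a b)

  _≟ᶜ_ : DecidableEquality (Fin 4 × Fin k)
  _≟ᶜ_ = Product.≡-dec _≟ᶠ_ _≟ᶠ_

  edgeDist : Bool → Bool → ℕ
  edgeDist s t = if does (s ≟ᵇ t) then 0 else 1

  -- (e , i) identifies the private 4-cycle through a new vertex
  dNew : New → New → ℕ
  dNew x@(e , i , s) y@(f , j , t) =
    if does ((e , i) ≟ᶜ (f , j)) then edgeDist s t else 2 + d₄ (anchor x) (anchor y)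

  d : V G → V G → ℕ
  d (inj₁ a) (inj₁ b) = d₄ a b
  d (inj₁ a) (inj₂ y) = suc (d₄ a (anchor y))
  d (inj₂ x) (inj₁ b) = suc (d₄ (anchor x) b)
  d (inj₂ x) (inj₂ y) = dNew x y

  dNew-same : ∀ e i s t → dNew (e , i , s) (e , i , t) ≡ edgeDist s t
  dNew-same e i s t =
    cong (λ b → if b then edgeDist s t else 2 + d₄ (anchor (e , i , s)) (anchor (e , i , t)))
         (dec-true ((e , i) ≟ᶜ (e , i)) refl)

  dNew-apart : ∀ {e i f j} s t → (e , i) ≢ (f , j) →
               dNew (e , i , s) (f , j , t) ≡ 2 + d₄ (anchor (e , i , s)) (anchor (f , j , t))
  dNew-apart {e} {i} {f} {j} s t apart =
    cong (λ b → if b then edgeDist s t else 2 + d₄ (anchor (e , i , s)) (anchor (f , j , t)))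
         (dec-false ((e , i) ≟ᶜ (f , j)) apart)

  edgeDist≤1 : ∀ s t → edgeDist s t ≤ 1
  edgeDist≤1 false false = z≤n
  edgeDist≤1 false true  = s≤s z≤n
  edgeDist≤1 true  false = s≤s z≤n
  edgeDist≤1 true  true  = z≤n

  dNew≤ : ∀ x y → dNew x y ≤ 2 + d₄ (anchor x) (anchor y)
  dNew≤ (e , i , s) (f , j , t) with (e , i) ≟ᶜ (f , j)
  ... | yes _ = ≤-trans (edgeDist≤1 s t) (s≤s z≤n)
  ... | no _  = ≤-refl

  d₄-anchor≤dNew : ∀ x y → d₄ (anchor x) (anchor y) ≤ dNew x y
  d₄-anchor≤dNew (e , i , s) (f , j , t) with (e , i) ≟ᶜ (f , j)
  ... | no _     = m≤n+m _ 2
  ... | yes refl = twins s t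
    where
    twins : ∀ s t → d₄ (anchor (e , i , s)) (anchor (e , i , t)) ≤ edgeDist s t
    twins false false = ≤-reflexive (d₄-refl e)
    twins false true  = d₄-adjacent (fwd e)
    twins true  false = d₄-adjacent (bwd e)
    twins true  true  = ≤-reflexive (d₄-refl (next e))

  dNew-twin-step : ∀ e i s z → dNew (e , i , s) z ≤ suc (dNew (e , i , not s) z)
  dNew-twin-step e i s (f , j , t) with (e , i) ≟ᶜ (f , j)
  ... | yes _ = ≤-trans (edgeDist≤1 s t) (s≤s z≤n)
  ... | no _  = s≤s (s≤s (anchor-step s (anchor (f , j , t))))
    where
    anchor-step : ∀ s b → d₄ (anchor (e , i , s)) b ≤ suc (d₄ (anchor (e , i , not s)) b)
    anchor-step false = d₄-step (fwd e)
    anchor-step true  = d₄-step (bwd e)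

  d-refl : ∀ x → d x x ≡ 0
  d-refl (inj₁ a)           = d₄-refl a
  d-refl (inj₂ (e , i , s)) = trans (dNew-same e i s s) (edgeDist-refl s)
    where
    edgeDist-refl : ∀ s → edgeDist s s ≡ 0
    edgeDist-refl false = refl
    edgeDist-refl true  = refl

  d-step : ∀ {x y} → AdjG k x y → ∀ z → d x z ≤ suc (d y z)
  d-step (cyc a)     (inj₁ b) = d₄-step (fwd a) b
  d-step (cyc a)     (inj₂ z) = s≤s (d₄-step (fwd a) (anchor z))
  d-step (cyc' a)    (inj₁ b) = d₄-step (bwd a) b
  d-step (cyc' a)    (inj₂ z) = s≤s (d₄-step (bwd a) (anchor z))
  d-step (legA e i)  (inj₁ b) = m≤n+m _ 2
  d-step (legA e i)  (inj₂ z) = s≤s (d₄-anchor≤dNew (e , i , false) z)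
  d-step (legA' e i) (inj₁ b) = ≤-refl
  d-step (legA' e i) (inj₂ z) = dNew≤ (e , i , false) z
  d-step (mid e i)   (inj₁ b) = s≤s (d₄-step (fwd e) b)
  d-step (mid e i)   (inj₂ z) = dNew-twin-step e i false z
  d-step (mid' e i)  (inj₁ b) = s≤s (d₄-step (bwd e) b)
  d-step (mid' e i)  (inj₂ z) = dNew-twin-step e i true z
  d-step (legB e i)  (inj₁ b) = ≤-refl
  d-step (legB e i)  (inj₂ z) = dNew≤ (e , i , true) z
  d-step (legB' e i) (inj₁ b) = m≤n+m _ 2
  d-step (legB' e i) (inj₂ z) = s≤s (d₄-anchor≤dNew (e , i , true) z)

  open Lipschitz {G = G} d d-refl d-step

  geodesic⇒visible : ∀ {S x y} (w : Walk G x y) → len G w ≡ d x y →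
                     All (λ v → ¬ S v) (interior G w) → Visible G S x y
  geodesic⇒visible w len≡d avoid = w , len≤dist⇒isShortest w (≤-reflexive len≡d) , avoid

  len-alongCycle : ∀ a b → len G (alongCycle a b) ≡ d₄ a b
  len-alongCycle a b = len-mapʷ inj₁ step₄ (geodesic₄ a b)

  visible-new-cycle : ∀ {S : V G → Set} x a →
                      All (λ c → ¬ S (inj₁ c)) (initVertices (geodesic₄ (anchor x) a)) →
                      Visible G S (inj₂ x) (inj₁ a)
  visible-new-cycle x a avoid =
    geodesic⇒visible (leave x ∷ alongCycle (anchor x) a) (cong suc (len-alongCycle (anchor x) a))
      (subst (All _) (sym interior≡) (All.map⁺ avoid))
    where
    interior≡ : interior G (leave x ∷ alongCycle (anchor x) a) ≡
                map inj₁ (initVertices (geodesic₄ (anchor x) a))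
    interior≡ = trans (interior-∷ (leave x) _) (initVertices-mapʷ inj₁ step₄ _)

  visible-new-new : ∀ {S : V G → Set} x y → x ≢ y →
                    All (λ c → ¬ S (inj₁ c)) (initVertices (geodesic₄ (anchor x) (anchor y)) ∷ʳ anchor y) →
                    Visible G S (inj₂ x) (inj₂ y)
  visible-new-new (e , i , s) (f , j , t) x≢y avoid with (e , i) ≟ᶜ (f , j)
  ... | yes refl = twins s t x≢y
    where
    twins : ∀ {S : V G → Set} s t → (e , i , s) ≢ (e , i , t) →
            Visible G S (inj₂ (e , i , s)) (inj₂ (e , i , t))
    twins false false x≢y = ⊥-elim (x≢y refl)
    twins false true  _   = geodesic⇒visible (mid e i ∷ []) (sym (dNew-same e i false true)) []
    twins true  false _   = geodesic⇒visible (mid' e i ∷ []) (sym (dNew-same e i true false)) []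
    twins true  true  x≢y = ⊥-elim (x≢y refl)
  ... | no apart = geodesic⇒visible path len≡ (subst (All _) (sym interior≡) (All.map⁺ avoid))
    where
    x y : New
    x = e , i , s
    y = f , j , t
    path : Walk G (inj₂ x) (inj₂ y)
    path = leave x ∷ (alongCycle (anchor x) (anchor y) ▷ arrive y)
    len≡ : len G path ≡ dNew x y
    len≡ = trans (cong suc (trans (len-▷ _ (arrive y)) (cong suc (len-alongCycle (anchor x) (anchor y)))))
                 (sym (dNew-apart s t apart))
    interior≡ : interior G path ≡ map inj₁ (initVertices (geodesic₄ (anchor x) (anchor y)) ∷ʳ anchor y)
    interior≡ = begin
      interior G path
        ≡⟨ interior-∷ (leave x) _ ⟩
      initVertices (alongCycle (anchor x) (anchor y) ▷ arrive y)
        ≡⟨ initVertices-▷ _ (arrive y) ⟩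
      initVertices (alongCycle (anchor x) (anchor y)) ∷ʳ inj₁ (anchor y)
        ≡⟨ cong (_∷ʳ inj₁ (anchor y)) (initVertices-mapʷ inj₁ step₄ _) ⟩
      map inj₁ (initVertices (geodesic₄ (anchor x) (anchor y))) ∷ʳ inj₁ (anchor y)
        ≡⟨ map-++ inj₁ _ (anchor y ∷ []) ⟨
      map inj₁ (initVertices (geodesic₄ (anchor x) (anchor y)) ∷ʳ anchor y)
        ∎
      where open ≡-Reasoning

  cycleFree⇒mv : ∀ {S : V G → Set} → (∀ a → ¬ S (inj₁ a)) → IsMVSet G S
  cycleFree⇒mv free (inj₁ a) _        Sa _  _   = ⊥-elim (free a Sa)
  cycleFree⇒mv free (inj₂ _) (inj₁ b) _  Sb _   = ⊥-elim (free b Sb)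
  cycleFree⇒mv free (inj₂ x) (inj₂ y) _  _  x≢y =
    visible-new-new x y (x≢y ∘ cong inj₂) (All.tabulate λ {c} _ → free c)

  flip : ∀ {x y} → AdjG k x y → AdjG k y x
  flip (cyc a)     = cyc' a
  flip (cyc' a)    = cyc a
  flip (legA e i)  = legA' e i
  flip (legA' e i) = legA e i
  flip (mid e i)   = mid' e i
  flip (mid' e i)  = mid e i
  flip (legB e i)  = legB' e i
  flip (legB' e i) = legB e i

  open Symmetric {G = G} flip using (Visible-sym)

  shore : V G → Bool
  shore (inj₁ a) = side a
  shore (inj₂ x) = not (side (anchor x))

  shore-visible-new-cycle : ∀ x a → not (side (anchor x)) ≡ side a →
                            Visible G (λ v → shore v ≡ side a) (inj₂ x) (inj₁ a)
  shore-visible-new-cycle x a shore≡ =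
    visible-new-cycle x a
      (All.map (λ c∼x c∼a → not-¬ c∼x (trans c∼a (sym shore≡))) (initVertices-geodesic₄ (anchor x) a))

  shore-mv : ∀ s → IsMVSet G (λ v → shore v ≡ s)
  shore-mv _ (inj₁ a) (inj₁ b) refl b∼a _ =
    geodesic⇒visible (alongCycle a b) (len-alongCycle a b) (subst (All _) (sym interior≡) [])
    where
    interior≡ : interior G (alongCycle a b) ≡ []
    interior≡ = trans (interior-mapʷ inj₁ step₄ _) (cong (map inj₁) (interior-geodesic₄ a b (sym b∼a)))
  shore-mv _ (inj₂ x) (inj₁ a) x∼a refl _ = shore-visible-new-cycle x a x∼a
  shore-mv _ (inj₁ a) (inj₂ x) refl x∼a _ = Visible-sym (shore-visible-new-cycle x a x∼a)
  shore-mv _ (inj₂ x) (inj₂ y) x∼y refl x≢y =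
    visible-new-new x y (x≢y ∘ cong inj₂)
      (All.∷ʳ⁺ (All.map avoid (initVertices-geodesic₄ (anchor x) (anchor y))) (not-¬ refl))
    where
    avoid : ∀ {c} → side c ≡ side (anchor x) → side c ≢ not (side (anchor y))
    avoid c∼x = not-¬ (trans c∼x (not-injective x∼y))

  colour : V G → Fin 2
  colour = Inverse.from 2↔Bool ∘ shore

  colour-mv : IsMVColoring G 2 colour
  colour-mv j = IsMVSet-⊆ shore≡ (shore-mv (Inverse.to 2↔Bool j))
    where
    shore≡ : ∀ v → colour v ≡ j → shore v ≡ Inverse.to 2↔Bool j
    shore≡ v refl = sym (Inverse.strictlyInverseˡ 2↔Bool (shore v))

  whole-not-mv : ∀ {S : V G → Set} → (∀ v → S v) → ¬ IsMVSet G S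
  whole-not-mv {S} everything mv with mv (inj₁ 0F) (inj₁ 2F) (everything _) (everything _) (λ ())
  ... | w , _ , avoid = blocked w (dist≤len w) avoid
    where
    blocked : (w : Walk G (inj₁ 0F) (inj₁ 2F)) → 2 ≤ len G w → ¬ All (λ v → ¬ S v) (interior G w)
    blocked (_ ∷ _ ∷ _) _ (¬S ∷ _) = ¬S (everything _)
    blocked (_ ∷ []) (s≤s ())

  two≤colours : ∀ c (col : V G → Fin c) → IsMVColoring G c col → 2 ≤ c
  two≤colours 0 col _ with col (inj₁ 0F)
  ... | ()
  two≤colours 1 col mv = ⊥-elim (whole-not-mv (λ v → only (col v)) (mv zero))
    where
    only : (j : Fin 1) → j ≡ zero
    only zero = refl
  two≤colours (suc (suc _)) _ _ = s≤s (s≤s z≤n)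

  corner-dist : ∀ b i → d (inj₂ (next b , i , false)) (inj₂ (b , i , true)) ≡ 2
  corner-dist 0F i = refl
  corner-dist 1F i = refl
  corner-dist 2F i = refl
  corner-dist 3F i = refl

  corner-interior : ∀ b i (w : Walk G (inj₂ (next b , i , false)) (inj₂ (b , i , true))) →
                    len G w ≡ 2 → interior G w ≡ inj₁ (next b) ∷ []
  corner-interior b i (p ∷ q ∷ []) _ = two-edges p q
    where
    two-edges : ∀ {u} (p : AdjG k (inj₂ (next b , i , false)) u) (q : AdjG k u (inj₂ (b , i , true))) →
                interior G (p ∷ q ∷ []) ≡ inj₁ (next b) ∷ []
    two-edges (legA' _ _) (legB' _ _) = refl
    two-edges (mid _ _)   ()
  corner-interior b i (_ ∷ []) ()
  corner-interior b i (_ ∷ _ ∷ _ ∷ _) ()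

  corner-blocks : ∀ {S : V G → Set} b i → IsMVSet G S →
                  S (inj₁ (next b)) → S (inj₂ (next b , i , false)) → ¬ S (inj₂ (b , i , true))
  corner-blocks b i mv S₁ S₂ S₃ with mv _ _ S₂ S₃ (λ ())
  ... | w , shortest , avoid = All.head (subst (All _) (corner-interior b i w len≡2) avoid) S₁
    where
    len≡2 : len G w ≡ 2
    len≡2 = ≤-antisym (shortest (legA' (next b) i ∷ legB' b i ∷ []))
                      (subst (_≤ len G w) (corner-dist b i) (dist≤len w))

  _≟ᵛ_ : DecidableEquality (V G)
  _≟ᵛ_ = Sum.≡-dec _≟ᶠ_ (Product.≡-dec _≟ᶠ_ (Product.≡-dec _≟ᶠ_ _≟ᵇ_))

  open import Data.List.Membership.DecPropositional _≟ᵛ_ using (_∈?_)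

  vertexAnchor : V G → Fin 4
  vertexAnchor (inj₁ a) = a
  vertexAnchor (inj₂ x) = anchor x

  missing-at : ∀ (i : Fin k) (S : List (V G)) → IsMVSet G (_∈ S) →
               ∀ b → Σ (V G) λ v → v ∉ S × vertexAnchor v ≡ next b
  missing-at i S mv b
    with inj₁ (next b) ∈? S | inj₂ (next b , i , false) ∈? S | inj₂ (b , i , true) ∈? S
  ... | no ∉S | _     | _     = _ , ∉S , refl
  ... | yes _ | no ∉S | _     = _ , ∉S , refl
  ... | yes _ | yes _ | no ∉S = _ , ∉S , refl
  ... | yes ∈₁ | yes ∈₂ | yes ∈₃ = ⊥-elim (corner-blocks b i mv ∈₁ ∈₂ ∈₃)

  edgeIndices : List (Fin k × Bool)
  edgeIndices = cartesianProduct (allFin k) (false ∷ true ∷ [])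

  newVertices : List (V G)
  newVertices = map inj₂ (cartesianProduct (allFin 4) edgeIndices)

  cycle∉newVertices : ∀ a → inj₁ a ∉ newVertices
  cycle∉newVertices a a∈ with Membership.∈-map⁻ inj₂ a∈
  ... | _ , _ , ()

  allVertices : List (V G)
  allVertices = map inj₁ (allFin 4) ++ newVertices

  ∈-allVertices : ∀ v → v ∈ allVertices
  ∈-allVertices (inj₁ a) = Membership.∈-++⁺ˡ (Membership.∈-map⁺ inj₁ (Membership.∈-allFin a))
  ∈-allVertices (inj₂ (e , i , s)) =
    Membership.∈-++⁺ʳ (map inj₁ (allFin 4)) (Membership.∈-map⁺ inj₂
      (Membership.∈-cartesianProduct⁺ (Membership.∈-allFin e)
        (Membership.∈-cartesianProduct⁺ (Membership.∈-allFin i) (∈-bools s))))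
    where
    ∈-bools : ∀ s → s ∈ false ∷ true ∷ []
    ∈-bools false = here refl
    ∈-bools true  = there (here refl)

  length-newVertices : length newVertices ≡ 8 * k
  length-newVertices = begin
    length newVertices                    ≡⟨ length-map inj₂ (cartesianProduct (allFin 4) edgeIndices) ⟩
    length (cartesianProduct (allFin 4) edgeIndices)
                                          ≡⟨ length-cartesianProduct (allFin 4) edgeIndices ⟩
    4 * length edgeIndices                ≡⟨ cong (4 *_) (length-cartesianProduct (allFin k) _) ⟩
    4 * (length (allFin k) * 2)           ≡⟨ cong (λ n → 4 * (n * 2)) (length-tabulate {n = k} (λ i → i)) ⟩
    4 * (k * 2)                           ≡⟨ cong (4 *_) (*-comm k 2) ⟩
    4 * (2 * k)                           ≡⟨ *-assoc 4 2 k ⟨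
    8 * k                                 ∎
    where open ≡-Reasoning

  unique-newVertices : Unique newVertices
  unique-newVertices =
    Unique.map⁺ Sum.inj₂-injective
      (Unique.cartesianProduct⁺ (Unique.allFin⁺ 4)
        (Unique.cartesianProduct⁺ (Unique.allFin⁺ k) (((λ ()) ∷ []) ∷ [] ∷ [])))

  mv-length≤ : Fin k → ∀ S → Unique S → IsMVSet G (_∈ S) → length S ≤ 8 * k
  mv-length≤ i S unique mv = +-cancelˡ-≤ 4 _ _ (begin
    4 + length S              ≤⟨ Unique⇒length≤ unique-missing⁺S (λ {v} _ → ∈-allVertices v) ⟩
    length allVertices        ≡⟨ cong (4 +_) length-newVertices ⟩
    4 + 8 * k                 ∎)
    where
    open ≤-Reasoning
    missing : Fin 4 → V G
    missing b = proj₁ (missing-at i S mv b)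
    missing∉S : ∀ b → missing b ∉ S
    missing∉S b = proj₁ (proj₂ (missing-at i S mv b))
    anchor-missing : ∀ b → vertexAnchor (missing b) ≡ next b
    anchor-missing b = proj₂ (proj₂ (missing-at i S mv b))
    apart : ∀ b b' → next b ≢ next b' → missing b ≢ missing b'
    apart b b' ne eq = ne (trans (sym (anchor-missing b)) (trans (cong vertexAnchor eq) (anchor-missing b')))
    outside : ∀ b → All (missing b ≢_) S
    outside b = All.tabulate λ v∈S eq → missing∉S b (subst (_∈ S) (sym eq) v∈S)
    unique-missing⁺S : Unique (missing 0F ∷ missing 1F ∷ missing 2F ∷ missing 3F ∷ S)
    unique-missing⁺S =
        (apart 0F 1F (λ ()) ∷ apart 0F 2F (λ ()) ∷ apart 0F 3F (λ ()) ∷ outside 0F)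
      ∷ (apart 1F 2F (λ ()) ∷ apart 1F 3F (λ ()) ∷ outside 1F)
      ∷ (apart 2F 3F (λ ()) ∷ outside 2F)
      ∷ outside 3F
      ∷ unique

proposition4p2 : ∀ (k : ℕ) → 1 ≤ k → MuEq (Gk k) (8 * k) × ChiMuEq (Gk k) 2
proposition4p2 (suc k) _ =
  ( (newVertices , unique-newVertices , cycleFree⇒mv cycle∉newVertices , length-newVertices)
  , mv-length≤ zero )
  , (colour , colour-mv) , two≤colours
  where open Gₖ (suc k)
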